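{- Let $n\ge1$ and let $\{y_w\}$ be commuting indeterminates indexed by nonempty boolean words $w$ of length at most $n-1$. For compositions $I,J$ of $n$, $$\langle Q_I,P_J\rangle=\prod_{k=1}^{n-1}\bigl(y^k(I)-y_k(J)\bigr),$$ and this is zero whenever $I\neq J$, while for $I=J$ it is a nonzero polynomial. Thus $(P_I)$ and $(Q_I)$ are adjoint bases up to normalization.
   Context: Identify the degree-$n$ component $\mathbf{Sym}_n$ of noncommutative symmetric functions with the Grassmann algebra on anticommuting generators $\eta_1,\dots,\eta_{n-1}$ via $R_I\leftrightarrow \eta_{d_1}\eta_{d_2}\cdots\eta_{d_k}$, where $R_I$ is the ribbon basis and $\mathrm{Des}(I)=\{d_1<\dots<d_k\}$. Identify $QSym_n$ with the Grassmann algebra on $\xi_1,\dots,\xi_{n-1}$ via $F_I\leftrightarrow\xi_{d_1}\cdots\xi_{d_k}$ (fundamental quasi-symmetric functions), with the duality pairing $\langle\xi_D,\eta_E\rangle=\delta_{DE}$ (i.e. $\langle F_I,R_J\rangle=\delta_{IJ}$). Parameters are scalars commuting with everything. For $Z=(z_1,\dots,z_{n-1})$ put $K_n(Z)=(1+z_1\eta_1)(1+z_2\eta_2)\cdots(1+z_{n-1}\eta_{n-1})$ and $L_n(Z)=(z_1-\xi_1)\cdots(z_{n-1}-\xi_{n-1})$. A composition $I$ of $n$ is encoded by the boolean word $u=u_1\cdots u_{n-1}$ with $u_k=1$ iff $k\in\mathrm{Des}(I)$. Set $y_k(I)=y_{u_1\cdots u_k}$ and $y^k(I)=y_{u_1\cdots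 u_{k-1}\overline{u_k}}$ where $\overline{u_k}=1-u_k$. Define $P_I=K_n(y_1(I),\dots,y_{n-1}(I))$ and $Q_I=L_n(y^1(I),\dots,y^{n-1}(I))$. -}

module Defs where

open import Level using (Level)
open import Algebra.Bundles using (CommutativeRing)
open import Data.Bool using (Bool; true; false; not; _∧_; _∨_; if_then_else_)
open import Data.Nat using (ℕ; zero; suc; _<_; _≡ᵇ_) renaming (_+_ to _+ℕ_)
open import Data.Nat.ListAction using (sum)
open import Data.Bool.ListAction using (any)
open import Data.Fin using (Fin; toℕ)
open import Data.Vec using (Vec; []; _∷_; zipWith; tabulate; toList; lookup)
open import Data.List using (List; []; _∷_; [_]; _++_; map; foldr; allFin; take)
open import Data.List.Relation.Unary.All using (All)
open import Data.Fin.Subset using (Subset; ⁅_⁆)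
open import Relation.Binary.PropositionalEquality using (_≡_)

record Composition (n : ℕ) : Set where
  field
    parts    : List ℕ
    positive : All (λ i → 0 < i) parts
    sums     : sum parts ≡ n
open Composition public

descents : List ℕ → List ℕ
descents []            = []
descents (a ∷ [])      = []
descents (a ∷ b ∷ rest) = a ∷ map (a +ℕ_) (descents (b ∷ rest))

-- Boolean word u = u₁⋯u_m of a composition of m+1 : u_j = 1 iff j ∈ Des(I).
-- (Position i : Fin m stands for j = i+1.)
desWord : {m : ℕ} → Composition (suc m) → Vec Bool m
desWord I = tabulate (λ i → any (λ d → d ≡ᵇ suc (toℕ i)) (descents (parts I)))

-- y_k(I) = y_{u₁⋯u_k}   (k = i+1)
yLow : {a : Level} {A : Set a} {m : ℕ} → (List Bool → A) → Composition (suc m) → Fin m → A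
yLow y I i = y (take (suc (toℕ i)) (toList (desWord I)))

-- y^k(I) = y_{u₁⋯u_{k-1} ū_k}   (k = i+1)
yUp : {a : Level} {A : Set a} {m : ℕ} → (List Bool → A) → Composition (suc m) → Fin m → A
yUp y I i = y (take (toℕ i) (toList (desWord I)) ++ [ not (lookup (desWord I) i) ])

-- Grassmann (exterior) algebra over a commutative ring R on m generators
-- θ₁,…,θ_m (θ = η for Sym_n, θ = ξ for QSym_n).  An element is the
-- function D ↦ coefficient of the ordered monomial θ_{d₁}⋯θ_{d_k}
-- (d₁<⋯<d_k, D = {d₁,…,d_k} ⊆ {1..m}, encoded as Subset m).

module Grassmann {c ℓ} (R : CommutativeRing c ℓ) where
  open CommutativeRing R

  allSubsets : (m : ℕ) → List (Subset m)
  allSubsets zero    = [ [] ]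
  allSubsets (suc m) = map (false ∷_) (allSubsets m) ++ map (true ∷_) (allSubsets m)

  Σ[_] : {A : Set} → List A → (A → Carrier) → Carrier
  Σ[ xs ] f = foldr (λ x acc → f x + acc) 0# xs

  Gr : ℕ → Set c
  Gr m = Subset m → Carrier

  _==_ : {m : ℕ} → Subset m → Subset m → Bool
  [] == [] = true
  (x ∷ xs) == (y ∷ ys) = (if x then y else not y) ∧ (xs == ys)

  isEmpty : {m : ℕ} → Subset m → Bool
  isEmpty []       = true
  isEmpty (x ∷ xs) = not x ∧ isEmpty xs

  disjoint : {m : ℕ} → Subset m → Subset m → Bool
  disjoint D E = isEmpty (zipWith _∧_ D E)

  count : {m : ℕ} → Subset m → ℕ
  count []           = 0
  count (true ∷ xs)  = suc (count xs)
  count (false ∷ xs) = count xs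

  -- number of pairs (d,e) with d ∈ D, e ∈ E, d > e
  inversions : {m : ℕ} → Subset m → Subset m → ℕ
  inversions []      []      = 0
  inversions (d ∷ D) (e ∷ E) = (if e then count D else 0) +ℕ inversions D E

  sign : ℕ → Carrier
  sign zero    = 1#
  sign (suc k) = - sign k

  -- θ_D θ_E = 0 if D ∩ E ≠ ∅, else (-1)^{inv(D,E)} θ_{D ∪ E}
  _·_ : {m : ℕ} → Gr m → Gr m → Gr m
  _·_ {m} a b S =
    Σ[ allSubsets m ] λ D → Σ[ allSubsets m ] λ E →
      if disjoint D E ∧ (zipWith _∨_ D E == S)
      then sign (inversions D E) * (a D * b E)
      else 0#

  _⊕_ : {m : ℕ} → Gr m → Gr m → Gr m
  (a ⊕ b) S = a S + b S

  _⊛_ : {m : ℕ} → Carrier → Gr m → Gr m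
  (z ⊛ a) S = z * a S

  one : {m : ℕ} → Gr m
  one S = if isEmpty S then 1# else 0#

  gen : {m : ℕ} → Fin m → Gr m
  gen i S = if S == ⁅ i ⁆ then 1# else 0#

  prod : {m : ℕ} → List (Gr m) → Gr m
  prod = foldr _·_ one

  -- K_n(Z) = (1 + z₁η₁)⋯(1 + z_{n-1}η_{n-1})   (m = n-1)
  K : (m : ℕ) → (Fin m → Carrier) → Gr m
  K m z = prod (map (λ i → one ⊕ (z i ⊛ gen i)) (allFin m))

  L : (m : ℕ) → (Fin m → Carrier) → Gr m
  L m z = prod (map (λ i → (z i ⊛ one) ⊕ ((- 1#) ⊛ gen i)) (allFin m))

  -- duality pairing ⟨ξ_D, η_E⟩ = δ_{DE}, extended bilinearly
  pairing : {m : ℕ} → Gr m → Gr m → Carrier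
  pairing {m} a b = Σ[ allSubsets m ] λ D → a D * b D

  P : {m : ℕ} → (List Bool → Carrier) → Composition (suc m) → Gr m
  P {m} y I = K m (yLow y I)

  Q : {m : ℕ} → (List Bool → Carrier) → Composition (suc m) → Gr m
  Q {m} y I = L m (yUp y I)

  prodDiff : {m : ℕ} → (List Bool → Carrier) → Composition (suc m) → Composition (suc m) → Carrier
  prodDiff {m} y I J = foldr (λ i acc → (yUp y I i - yLow y J i) * acc) 1# (allFin m)

module Submission where

-- Slicing a Grassmann element by whether its monomials contain the first generator, the pairing is
-- the sum of the pairings of the two slices.  The slices of K(w) are K(w′) and w₁ K(w′), those of
-- L(z) are z₁ L(z′) and -L(z′), where z′, w′ drop the first variable; hence
-- ⟨L(z), K(w)⟩ = (z₁ - w₁) ⟨L(z′), K(w′)⟩.  If I ≠ J, their descent words first differ at some k,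
-- and there y^k(I) and y_k(J) are the same variable, so that factor vanishes.  For I = J, putting
-- y_w = 1 or 0 according to the last letter of w makes every factor ±1.

open import Defs
open import Level using (Level)
open import Algebra.Bundles using (CommutativeRing)
open import Data.Bool using (Bool)
open import Data.Nat using (ℕ; suc)
open import Data.List using (List)
open import Data.Product using (_×_; ∃)
open import Data.Integer using (ℤ)
open import Data.Integer.Properties using (+-*-commutativeRing)
open import Relation.Binary.PropositionalEquality using (_≡_; _≢_)

open import Data.Bool using (true; false; not; _∧_; _∨_; if_then_else_)
open import Data.Bool.ListAction using (any)
open import Data.Bool.Properties using (¬-not; ∨-identityˡ; ∧-zeroˡ)
import Data.Bool as Bool
open import Data.Empty using (⊥-elim)
open import Data.Fin using (Fin; zero; suc; toℕ; fromℕ<)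
open import Data.Fin.Properties using (toℕ-fromℕ<)
open import Data.Fin.Subset using (Subset; Side; inside; outside) renaming (⊥ to ∅)
open import Data.Integer using (∣_∣; 0ℤ; 1ℤ) renaming (_-_ to _-ℤ_)
open import Data.Integer.Properties using (abs-*)
open import Data.List using ([]; _∷_; [_]; _++_; map; foldr; take; last; allFin; tabulate)
open import Data.List.Properties using (map-tabulate; foldr-map)
open import Data.List.Membership.Propositional using (_∈_)
open import Data.List.Membership.Propositional.Properties using (∈-allFin)
open import Data.List.Relation.Unary.All using (All; []; _∷_)
open import Data.List.Relation.Unary.Any using (here; there)
open import Data.Maybe using (just; maybe)
open import Data.Nat using (zero; _<_; _≤_; _≡ᵇ_) renaming (_+_ to _+ℕ_)
open import Data.Nat.ListAction using (sum)
open import Data.Nat.Properties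
  using (≡ᵇ⇒≡; <⇒≢; >⇒≢; <⇒≱; n≮0; <-≤-trans; <-cmp; m≤m+n; m≤n+m; m<m+n; +-monoʳ-<; +-cancelˡ-≡; ≤-pred)
  renaming (+-identityʳ to +ℕ-identityʳ)
open import Data.Product using (_,_; proj₁; proj₂)
open import Data.Vec using (Vec; []; _∷_; zipWith; toList; lookup)
open import Data.Vec.Properties using (lookup∘tabulate; zipWith-identityˡ; zipWith-zeroˡ)
open import Function using (_∘_)
open import Relation.Binary using (tri<; tri≈; tri>)
open import Relation.Binary.PropositionalEquality using (refl; sym; trans; cong; cong₂; subst; ≢-sym)
open import Relation.Binary.PropositionalEquality.Properties using (module ≡-Reasoning)
open import Relation.Nullary using (¬_; yes; no; contradiction)

-- Descent words

hasDescentAt : List ℕ → ℕ → Bool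
hasDescentAt p j = any (_≡ᵇ j) (descents p)

≡ᵇ-refl : ∀ n → (n ≡ᵇ n) ≡ true
≡ᵇ-refl zero    = refl
≡ᵇ-refl (suc n) = ≡ᵇ-refl n

≢⇒≡ᵇ≡false : ∀ {m n} → m ≢ n → (m ≡ᵇ n) ≡ false
≢⇒≡ᵇ≡false {m} {n} m≢n = ¬-not λ m≡ᵇn → m≢n (≡ᵇ⇒≡ m n (subst Bool.T (sym m≡ᵇn) _))

any-≡ᵇ-map-+ : ∀ a j xs → any (_≡ᵇ (a +ℕ j)) (map (a +ℕ_) xs) ≡ any (_≡ᵇ j) xs
any-≡ᵇ-map-+ a j []       = refl
any-≡ᵇ-map-+ a j (x ∷ xs) = cong₂ _∨_ (+-≡ᵇ a) (any-≡ᵇ-map-+ a j xs)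
  where
  +-≡ᵇ : ∀ a → ((a +ℕ x) ≡ᵇ (a +ℕ j)) ≡ (x ≡ᵇ j)
  +-≡ᵇ zero    = refl
  +-≡ᵇ (suc a) = +-≡ᵇ a

any-≡ᵇ-map-+-below : ∀ {a j} xs → j < a → any (_≡ᵇ j) (map (a +ℕ_) xs) ≡ false
any-≡ᵇ-map-+-below         []       j<a = refl
any-≡ᵇ-map-+-below {a} {j} (x ∷ xs) j<a =
  cong₂ _∨_ (≢⇒≡ᵇ≡false (>⇒≢ (<-≤-trans j<a (m≤m+n a x)))) (any-≡ᵇ-map-+-below xs j<a)

hasDescentAt-head : ∀ a b p → hasDescentAt (a ∷ b ∷ p) a ≡ true
hasDescentAt-head a b p = cong (_∨ any (_≡ᵇ a) (map (a +ℕ_) (descents (b ∷ p)))) (≡ᵇ-refl a)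

hasDescentAt-below : ∀ {a j} p → j < a → hasDescentAt (a ∷ p) j ≡ false
hasDescentAt-below []      j<a = refl
hasDescentAt-below (b ∷ p) j<a =
  cong₂ _∨_ (≢⇒≡ᵇ≡false (>⇒≢ j<a)) (any-≡ᵇ-map-+-below (descents (b ∷ p)) j<a)

hasDescentAt-+ : ∀ a b p {j} → 0 < j → hasDescentAt (a ∷ b ∷ p) (a +ℕ j) ≡ hasDescentAt (b ∷ p) j
hasDescentAt-+ a b p {j} 0<j =
  cong₂ _∨_ (≢⇒≡ᵇ≡false (<⇒≢ (m<m+n a 0<j))) (any-≡ᵇ-map-+ a j (descents (b ∷ p)))

Positive : List ℕ → Set
Positive = All (0 <_)

SameDescentsBelow : ℕ → List ℕ → List ℕ → Set
SameDescentsBelow n p q = ∀ j → 0 < j → j < n → hasDescentAt p j ≡ hasDescentAt q j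

first-part-not-< : ∀ {a b} p q → 0 < a → Positive p → sum (a ∷ p) ≡ sum (b ∷ q) →
                   SameDescentsBelow (sum (a ∷ p)) (a ∷ p) (b ∷ q) → ¬ a < b
first-part-not-< {a} {b} [] q 0<a _ eq _ a<b =
  <⇒≱ a<b (subst (b ≤_) (trans (sym eq) (+ℕ-identityʳ a)) (m≤m+n b (sum q)))
first-part-not-< {a} {b} (a′ ∷ p) q 0<a (0<a′ ∷ _) _ same a<b =
  contradiction (trans (sym (hasDescentAt-head a a′ p)) (trans (same a 0<a a<sum) (hasDescentAt-below q a<b))) λ ()
  where
  a<sum : a < sum (a ∷ a′ ∷ p)
  a<sum = m<m+n a (<-≤-trans 0<a′ (m≤m+n a′ (sum p)))

tails-sameDescents : ∀ a p q → sum p ≡ sum q →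
                     SameDescentsBelow (sum (a ∷ p)) (a ∷ p) (a ∷ q) → SameDescentsBelow (sum p) p q
tails-sameDescents a []      q       eq same j 0<j ()
tails-sameDescents a (b ∷ p) []      eq same j 0<j j<s = contradiction (subst (j <_) eq j<s) n≮0
tails-sameDescents a (b ∷ p) (c ∷ q) eq same j 0<j j<s = begin
  hasDescentAt (b ∷ p) j           ≡⟨ sym (hasDescentAt-+ a b p 0<j) ⟩
  hasDescentAt (a ∷ b ∷ p) (a +ℕ j) ≡⟨ same (a +ℕ j) (<-≤-trans 0<j (m≤n+m j a)) (+-monoʳ-< a j<s) ⟩
  hasDescentAt (a ∷ c ∷ q) (a +ℕ j) ≡⟨ hasDescentAt-+ a c q 0<j ⟩
  hasDescentAt (c ∷ q) j           ∎
  where open ≡-Reasoning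

descents-injective : ∀ p q → Positive p → Positive q → sum p ≡ sum q →
                     SameDescentsBelow (sum p) p q → p ≡ q
descents-injective []      []      _          _          _  _ = refl
descents-injective []      (b ∷ q) _          (0<b ∷ _)  eq _ = contradiction eq (<⇒≢ (<-≤-trans 0<b (m≤m+n b (sum q))))
descents-injective (a ∷ p) []      (0<a ∷ _)  _          eq _ = contradiction eq (>⇒≢ (<-≤-trans 0<a (m≤m+n a (sum p))))
descents-injective (a ∷ p) (b ∷ q) (0<a ∷ pp) (0<b ∷ pq) eq same with <-cmp a b
... | tri< a<b _ _ = ⊥-elim (first-part-not-< p q 0<a pp eq same a<b)
... | tri> _ _ b<a = ⊥-elim (first-part-not-< q p 0<b pq (sym eq) same′ b<a)
  where
  same′ : SameDescentsBelow (sum (b ∷ q)) (b ∷ q) (a ∷ p)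
  same′ j 0<j j<n = sym (same j 0<j (subst (j <_) (sym eq) j<n))
... | tri≈ _ refl _ = cong (a ∷_) (descents-injective p q pp pq tails-eq (tails-sameDescents a p q tails-eq same))
  where
  tails-eq : sum p ≡ sum q
  tails-eq = +-cancelˡ-≡ a (sum p) (sum q) eq

lookup-desWord : ∀ {m} (I : Composition (suc m)) i → lookup (desWord I) i ≡ hasDescentAt (parts I) (suc (toℕ i))
lookup-desWord I i = lookup∘tabulate _ i

desWord-injective : ∀ {m} (I J : Composition (suc m)) → desWord I ≡ desWord J → parts I ≡ parts J
desWord-injective {m} I J eq =
  descents-injective (parts I) (parts J) (positive I) (positive J) (trans (sums I) (sym (sums J))) same
  where
  same : SameDescentsBelow (sum (parts I)) (parts I) (parts J)
  same (suc j) _ j<n =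
    subst (λ k → hasDescentAt (parts I) (suc k) ≡ hasDescentAt (parts J) (suc k)) (toℕ-fromℕ< j<m)
      (trans (sym (lookup-desWord I i)) (trans (cong (λ u → lookup u i) eq) (lookup-desWord J i)))
    where
    j<m : j < m
    j<m = ≤-pred (subst (suc j <_) (sums I) j<n)
    i : Fin m
    i = fromℕ< j<m

firstDifference : ∀ {m} (u v : Vec Bool m) → u ≢ v →
                  ∃ λ i → take (toℕ i) (toList u) ≡ take (toℕ i) (toList v) × lookup u i ≢ lookup v i
firstDifference []      []      u≢v = ⊥-elim (u≢v refl)
firstDifference (a ∷ u) (b ∷ v) u≢v with a Bool.≟ b
... | no a≢b = zero , refl , a≢b
... | yes refl with firstDifference u v (u≢v ∘ cong (a ∷_))
...   | i , same , differ = suc i , cong (a ∷_) same , differ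

take-suc-toList : ∀ {a} {A : Set a} {m} (u : Vec A m) i →
                  take (suc (toℕ i)) (toList u) ≡ take (toℕ i) (toList u) ++ [ lookup u i ]
take-suc-toList (a ∷ u) zero    = refl
take-suc-toList (a ∷ u) (suc i) = cong (a ∷_) (take-suc-toList u i)

≢⇒∃yUp≡yLow : ∀ {a} {A : Set a} {m} (y : List Bool → A) (I J : Composition (suc m)) →
              parts I ≢ parts J → ∃ λ i → yUp y I i ≡ yLow y J i
≢⇒∃yUp≡yLow y I J I≢J with firstDifference (desWord I) (desWord J) (I≢J ∘ desWord-injective I J)
... | i , same , differ = i , cong y (begin
  take (toℕ i) (toList u) ++ [ not (lookup u i) ] ≡⟨ cong₂ (λ w b → w ++ [ b ]) same (sym (¬-not (≢-sym differ))) ⟩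
  take (toℕ i) (toList v) ++ [ lookup v i ]       ≡⟨ sym (take-suc-toList v i) ⟩
  take (suc (toℕ i)) (toList v)                   ∎)
  where
  open ≡-Reasoning
  u = desWord I
  v = desWord J

module Product {c ℓ} (R : CommutativeRing c ℓ) where
  open CommutativeRing R renaming (refl to ≈-refl; sym to ≈-sym; trans to ≈-trans) hiding (zero)

  ∏[_] : {A : Set} → List A → (A → Carrier) → Carrier
  ∏[ xs ] f = foldr (λ x acc → f x * acc) 1# xs

  ∏-allFin-suc : ∀ {m} (f : Fin (suc m) → Carrier) → ∏[ allFin (suc m) ] f ≡ f zero * ∏[ allFin m ] (f ∘ suc)
  ∏-allFin-suc {m} f = cong (f zero *_) (begin
    foldr step 1# (tabulate suc)            ≡⟨ cong (foldr step 1#) (sym (map-tabulate (λ i → i) suc)) ⟩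
    foldr step 1# (map suc (allFin m))      ≡⟨ foldr-map step suc 1# (allFin m) ⟩
    ∏[ allFin m ] (f ∘ suc)                 ∎)
    where
    open ≡-Reasoning
    step : Fin (suc m) → Carrier → Carrier
    step i acc = f i * acc

  ∏-zero : ∀ {A : Set} {f : A → Carrier} {x} xs → x ∈ xs → f x ≈ 0# → ∏[ xs ] f ≈ 0#
  ∏-zero (_ ∷ xs) (here refl) fx≈0 = ≈-trans (*-congʳ fx≈0) (zeroˡ _)
  ∏-zero (_ ∷ xs) (there x∈xs)  fx≈0 = ≈-trans (*-congˡ (∏-zero xs x∈xs fx≈0)) (zeroʳ _)

module GrassmannProperties {c ℓ} (R : CommutativeRing c ℓ) where
  open CommutativeRing R renaming (refl to ≈-refl; sym to ≈-sym; trans to ≈-trans) hiding (zero)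
  open Grassmann R
  open Product R
  open import Algebra.Properties.Ring ring using (-1*x≈-x)
  open import Algebra.Properties.CommutativeSemigroup *-commutativeSemigroup using (interchange)
  open import Relation.Binary.Reasoning.Setoid setoid

  infix 4 _≐_
  _≐_ : ∀ {m} → Gr m → Gr m → Set ℓ
  a ≐ b = ∀ S → a S ≈ b S

  𝟘 : ∀ {m} → Gr m
  𝟘 _ = 0#

  -- a = slice outside a + θ₁ · slice inside a, both slices being written in the generators θ₂,…
  slice : ∀ {m} → Side → Gr (suc m) → Gr m
  slice s a S = a (s ∷ S)

  Σ-cong : ∀ {A : Set} (xs : List A) {f g : A → Carrier} → (∀ x → f x ≈ g x) → Σ[ xs ] f ≈ Σ[ xs ] g
  Σ-cong []       f≈g = ≈-refl
  Σ-cong (x ∷ xs) f≈g = +-cong (f≈g x) (Σ-cong xs f≈g)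

  Σ-zero : ∀ {A : Set} (xs : List A) {f : A → Carrier} → (∀ x → f x ≈ 0#) → Σ[ xs ] f ≈ 0#
  Σ-zero []       f≈0 = ≈-refl
  Σ-zero (x ∷ xs) f≈0 = ≈-trans (+-cong (f≈0 x) (Σ-zero xs f≈0)) (+-identityˡ 0#)

  Σ-*ˡ : ∀ {A : Set} (xs : List A) k (f : A → Carrier) → Σ[ xs ] (λ x → k * f x) ≈ k * Σ[ xs ] f
  Σ-*ˡ []       k f = ≈-sym (zeroʳ k)
  Σ-*ˡ (x ∷ xs) k f = ≈-trans (+-congˡ (Σ-*ˡ xs k f)) (≈-sym (distribˡ k (f x) _))

  Σ-++ : ∀ {A : Set} (xs ys : List A) (f : A → Carrier) → Σ[ xs ++ ys ] f ≈ Σ[ xs ] f + Σ[ ys ] f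
  Σ-++ []       ys f = ≈-sym (+-identityˡ _)
  Σ-++ (x ∷ xs) ys f = ≈-trans (+-congˡ (Σ-++ xs ys f)) (≈-sym (+-assoc _ _ _))

  Σ-map : ∀ {A B : Set} (h : A → B) (xs : List A) (f : B → Carrier) → Σ[ map h xs ] f ≡ Σ[ xs ] (f ∘ h)
  Σ-map h xs f = foldr-map _ h 0# xs

  Σ-subsets-suc : ∀ m (f : Subset (suc m) → Carrier) →
                  Σ[ allSubsets (suc m) ] f ≈ Σ[ allSubsets m ] (f ∘ (outside ∷_)) + Σ[ allSubsets m ] (f ∘ (inside ∷_))
  Σ-subsets-suc m f = ≈-trans (Σ-++ (map (outside ∷_) (allSubsets m)) _ f)
    (+-cong (reflexive (Σ-map (outside ∷_) (allSubsets m) f)) (reflexive (Σ-map (inside ∷_) (allSubsets m) f)))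

  Σ-subsets-supported : ∀ m (S : Subset m) (f : Subset m → Carrier) →
                        (∀ E → (E == S) ≡ false → f E ≈ 0#) → Σ[ allSubsets m ] f ≈ f S
  Σ-subsets-supported zero    []            f f≈0 = +-identityʳ _
  Σ-subsets-supported (suc m) (outside ∷ S) f f≈0 = begin
    Σ[ allSubsets (suc m) ] f                                                       ≈⟨ Σ-subsets-suc m f ⟩
    Σ[ allSubsets m ] (f ∘ (outside ∷_)) + Σ[ allSubsets m ] (f ∘ (inside ∷_))  ≈⟨ +-cong (Σ-subsets-supported m S _ (f≈0 ∘ (outside ∷_))) (Σ-zero (allSubsets m) (λ E → f≈0 (inside ∷ E) refl)) ⟩
    f (outside ∷ S) + 0#                                                            ≈⟨ +-identityʳ _ ⟩
    f (outside ∷ S)                                                                 ∎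
  Σ-subsets-supported (suc m) (inside ∷ S) f f≈0 = begin
    Σ[ allSubsets (suc m) ] f                                                       ≈⟨ Σ-subsets-suc m f ⟩
    Σ[ allSubsets m ] (f ∘ (outside ∷_)) + Σ[ allSubsets m ] (f ∘ (inside ∷_))  ≈⟨ +-cong (Σ-zero (allSubsets m) (λ E → f≈0 (outside ∷ E) refl)) (Σ-subsets-supported m S _ (f≈0 ∘ (inside ∷_))) ⟩
    0# + f (inside ∷ S)                                                             ≈⟨ +-identityˡ _ ⟩
    f (inside ∷ S)                                                                  ∎

  ==-refl : ∀ {m} (S : Subset m) → (S == S) ≡ true
  ==-refl []            = refl
  ==-refl (inside ∷ S)  = ==-refl S
  ==-refl (outside ∷ S) = ==-refl S

  Σ-subsets-δ : ∀ m (S : Subset m) (g : Subset m → Carrier) →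
                Σ[ allSubsets m ] (λ E → if E == S then g E else 0#) ≈ g S
  Σ-subsets-δ m S g = ≈-trans (Σ-subsets-supported m S _ vanish) (reflexive (cong (if_then g S else 0#) (==-refl S)))
    where
    vanish : ∀ E → (E == S) ≡ false → (if E == S then g E else 0#) ≈ 0#
    vanish E E≠S rewrite E≠S = ≈-refl

  isEmpty-∅ : ∀ m → isEmpty (∅ {m}) ≡ true
  isEmpty-∅ zero    = refl
  isEmpty-∅ (suc m) = isEmpty-∅ m

  count-∅ : ∀ m → count (∅ {m}) ≡ 0
  count-∅ zero    = refl
  count-∅ (suc m) = count-∅ m

  inversions-∅ˡ : ∀ {m} (E : Subset m) → inversions ∅ E ≡ 0
  inversions-∅ˡ []                      = refl
  inversions-∅ˡ         (outside ∷ E) = inversions-∅ˡ E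
  inversions-∅ˡ {suc m} (inside ∷ E)  rewrite count-∅ m = inversions-∅ˡ E

  disjoint-∅ˡ : ∀ {m} (E : Subset m) → disjoint ∅ E ≡ true
  disjoint-∅ˡ {m} E = trans (cong isEmpty (zipWith-zeroˡ ∧-zeroˡ E)) (isEmpty-∅ m)

  ==-∅ : ∀ {m} (S : Subset m) → (S == ∅) ≡ isEmpty S
  ==-∅ []            = refl
  ==-∅ (inside ∷ S)  = refl
  ==-∅ (outside ∷ S) = ==-∅ S

  ∅-·-coefficient : ∀ {m} (E S : Subset m) v →
    (if disjoint ∅ E ∧ (zipWith _∨_ ∅ E == S) then sign (inversions ∅ E) * v else 0#) ≡ (if E == S then 1# * v else 0#)
  ∅-·-coefficient E S v rewrite disjoint-∅ˡ E | zipWith-identityˡ {f = _∨_} ∨-identityˡ E | inversions-∅ˡ E = refl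

  if-else-0-cong : ∀ b {x y} → x ≈ y → (if b then x else 0#) ≈ (if b then y else 0#)
  if-else-0-cong true  x≈y = x≈y
  if-else-0-cong false x≈y = ≈-refl

  if-else-0-zero : ∀ b {x} → x ≈ 0# → (if b then x else 0#) ≈ 0#
  if-else-0-zero true  x≈0 = x≈0
  if-else-0-zero false x≈0 = ≈-refl

  if-∧-false : ∀ b {x} → (if b ∧ false then x else 0#) ≈ 0#
  if-∧-false true  = ≈-refl
  if-∧-false false = ≈-refl

  ·-summand : ∀ {m} → Gr m → Gr m → Subset m → Subset m → Subset m → Carrier
  ·-summand a b S D E = if disjoint D E ∧ (zipWith _∨_ D E == S) then sign (inversions D E) * (a D * b E) else 0#

  ·-cong : ∀ {m} {a a′ b b′ : Gr m} → a ≐ a′ → b ≐ b′ → a · b ≐ a′ · b′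
  ·-cong {m} a≐a′ b≐b′ S = Σ-cong (allSubsets m) λ D → Σ-cong (allSubsets m) λ E →
    if-else-0-cong (disjoint D E ∧ _) (*-congˡ (*-cong (a≐a′ D) (b≐b′ E)))

  ·-zeroˡ : ∀ {m} {a : Gr m} (b : Gr m) → a ≐ 𝟘 → a · b ≐ 𝟘
  ·-zeroˡ {m} b a≐0 S = Σ-zero (allSubsets m) λ D → Σ-zero (allSubsets m) λ E →
    if-else-0-zero (disjoint D E ∧ _) (≈-trans (*-congˡ (≈-trans (*-congʳ (a≐0 D)) (zeroˡ _))) (zeroʳ _))

  ⊛one-· : ∀ {m} {a : Gr m} {k} (b : Gr m) → a ≐ k ⊛ one → a · b ≐ k ⊛ b
  ⊛one-· {m} {a} {k} b a≐k S = begin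
    (a · b) S                                                              ≈⟨ Σ-subsets-supported m ∅ _ off-∅ ⟩
    Σ[ allSubsets m ] (·-summand a b S ∅)                                  ≈⟨ Σ-cong (allSubsets m) (λ E → reflexive (∅-·-coefficient E S (a ∅ * b E))) ⟩
    Σ[ allSubsets m ] (λ E → if E == S then 1# * (a ∅ * b E) else 0#)   ≈⟨ Σ-subsets-δ m S _ ⟩
    1# * (a ∅ * b S)                                                       ≈⟨ *-identityˡ _ ⟩
    a ∅ * b S                                                              ≈⟨ *-congʳ a∅≈k ⟩
    k * b S                                                                ∎
    where
    a∅≈k : a ∅ ≈ k
    a∅≈k = ≈-trans (a≐k ∅) (≈-trans (*-congˡ (reflexive (cong (if_then 1# else 0#) (isEmpty-∅ m)))) (*-identityʳ k))
    off-∅ : ∀ D → (D == ∅) ≡ false → Σ[ allSubsets m ] (·-summand a b S D) ≈ 0#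
    off-∅ D D≠∅ = Σ-zero (allSubsets m) λ E → if-else-0-zero (disjoint D E ∧ _)
      (≈-trans (*-congˡ (≈-trans (*-congʳ aD≈0) (zeroˡ _))) (zeroʳ _))
      where
      aD≈0 : a D ≈ 0#
      aD≈0 = ≈-trans (a≐k D) (≈-trans (*-congˡ (reflexive (cong (if_then 1# else 0#) (trans (sym (==-∅ D)) D≠∅)))) (zeroʳ k))

  ·-restrict-outside : ∀ {m} {b : Gr (suc m)} (a : Gr (suc m)) → slice inside b ≐ 𝟘 →
    ∀ S → (a · b) S ≈ Σ[ allSubsets (suc m) ] (λ D → Σ[ allSubsets m ] (·-summand a b S D ∘ (outside ∷_)))
  ·-restrict-outside {m} {b} a b-in≐0 S = Σ-cong (allSubsets (suc m)) λ D → ≈-trans (Σ-subsets-suc m _)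
    (≈-trans (+-congˡ (Σ-zero (allSubsets m) λ E → if-else-0-zero (disjoint D (inside ∷ E) ∧ _)
                       (≈-trans (*-congˡ (≈-trans (*-congˡ (b-in≐0 E)) (zeroʳ _))) (zeroʳ _))))
           (+-identityʳ _))

  -- Since b has no monomial containing θ₁, in a product a · b the generator θ₁ can only come from a.
  slice-· : ∀ {m} {b : Gr (suc m)} (a : Gr (suc m)) → slice inside b ≐ 𝟘 → ∀ s → slice s (a · b) ≐ slice s a · slice outside b
  slice-· {m} a b-in≐0 outside S = ≈-trans (·-restrict-outside a b-in≐0 (outside ∷ S)) (≈-trans (Σ-subsets-suc m _)
    (≈-trans (+-congˡ (Σ-zero (allSubsets m) λ D → Σ-zero (allSubsets m) λ E → if-∧-false (disjoint D E))) (+-identityʳ _)))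
  slice-· {m} a b-in≐0 inside S = ≈-trans (·-restrict-outside a b-in≐0 (inside ∷ S)) (≈-trans (Σ-subsets-suc m _)
    (≈-trans (+-congʳ (Σ-zero (allSubsets m) λ D → Σ-zero (allSubsets m) λ E → if-∧-false (disjoint D E))) (+-identityˡ _)))

  prod-slice : ∀ {m} {A : Set} (G : A → Gr (suc m)) (H : A → Gr m) →
               (∀ x → slice inside (G x) ≐ 𝟘) → (∀ x → slice outside (G x) ≐ H x) → ∀ xs →
               slice inside (prod (map G xs)) ≐ 𝟘 × slice outside (prod (map G xs)) ≐ prod (map H xs)
  prod-slice G H G-in G-out []       = (λ S → ≈-refl) , (λ S → ≈-refl)
  prod-slice G H G-in G-out (x ∷ xs) =
      (λ S → ≈-trans (slice-· (G x) rest-in inside S) (·-zeroˡ _ (G-in x) S))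
    , (λ S → ≈-trans (slice-· (G x) rest-in outside S) (·-cong (G-out x) rest-out S))
    where
    rest = prod-slice G H G-in G-out xs
    rest-in = proj₁ rest
    rest-out = proj₂ rest

  Factors : Set c
  Factors = ∀ {m} → Carrier → Fin m → Gr m

  ∏ᴳ : Factors → (m : ℕ) → (Fin m → Carrier) → Gr m
  ∏ᴳ F m z = prod (map (λ i → F (z i) i) (allFin m))

  ∏ᴳ-slice : (F : Factors) → (∀ {m} x (i : Fin m) → slice inside (F x (suc i)) ≐ 𝟘) →
             (∀ {m} x (i : Fin m) → slice outside (F x (suc i)) ≐ F x i) →
             ∀ m z s {k} → slice s (F (z zero) zero) ≐ k ⊛ one → slice s (∏ᴳ F (suc m) z) ≐ k ⊛ ∏ᴳ F m (z ∘ suc)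
  ∏ᴳ-slice F F-in F-out m z s F₀≐k S =
    ≈-trans (slice-· (F (z zero) zero) rest-in s S) (≈-trans (·-cong (λ _ → ≈-refl) rest-out S) (⊛one-· _ F₀≐k S))
    where
    G : Fin m → Gr (suc m)
    G i = F (z (suc i)) (suc i)
    rest-≡ : map (λ i → F (z i) i) (tabulate suc) ≡ map G (allFin m)
    rest-≡ = trans (map-tabulate suc (λ i → F (z i) i)) (sym (map-tabulate (λ i → i) G))
    rest = prod-slice G (λ i → F (z (suc i)) i) (λ i → F-in (z (suc i)) i) (λ i → F-out (z (suc i)) i) (allFin m)
    rest-in : slice inside (prod (map (λ i → F (z i) i) (tabulate suc))) ≐ 𝟘
    rest-in rewrite rest-≡ = proj₁ rest
    rest-out : slice outside (prod (map (λ i → F (z i) i) (tabulate suc))) ≐ ∏ᴳ F m (z ∘ suc)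
    rest-out rewrite rest-≡ = proj₂ rest

  slice-inside-gen-zero : ∀ {m} → slice inside (gen {suc m} zero) ≐ one
  slice-inside-gen-zero S = reflexive (cong (if_then 1# else 0#) (==-∅ S))

  Kfactor : Factors
  Kfactor x i = one ⊕ (x ⊛ gen i)

  Lfactor : Factors
  Lfactor x i = (x ⊛ one) ⊕ ((- 1#) ⊛ gen i)

  Kfactor-suc-inside : ∀ {m} x (i : Fin m) → slice inside (Kfactor x (suc i)) ≐ 𝟘
  Kfactor-suc-inside x i S = ≈-trans (+-identityˡ _) (zeroʳ x)

  Lfactor-suc-inside : ∀ {m} x (i : Fin m) → slice inside (Lfactor x (suc i)) ≐ 𝟘
  Lfactor-suc-inside x i S = ≈-trans (+-cong (zeroʳ x) (zeroʳ _)) (+-identityʳ 0#)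

  K-slice : ∀ m z s {k} → slice s (Kfactor (z zero) zero) ≐ k ⊛ one → slice s (K (suc m) z) ≐ k ⊛ K m (z ∘ suc)
  K-slice = ∏ᴳ-slice Kfactor Kfactor-suc-inside (λ x i S → ≈-refl)

  L-slice : ∀ m z s {k} → slice s (Lfactor (z zero) zero) ≐ k ⊛ one → slice s (L (suc m) z) ≐ k ⊛ L m (z ∘ suc)
  L-slice = ∏ᴳ-slice Lfactor Lfactor-suc-inside (λ x i S → ≈-refl)

  K-slice-outside : ∀ m z → slice outside (K (suc m) z) ≐ 1# ⊛ K m (z ∘ suc)
  K-slice-outside m z = K-slice m z outside λ S →
    ≈-trans (+-congˡ (zeroʳ (z zero))) (≈-trans (+-identityʳ _) (≈-sym (*-identityˡ _)))

  K-slice-inside : ∀ m z → slice inside (K (suc m) z) ≐ z zero ⊛ K m (z ∘ suc)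
  K-slice-inside m z = K-slice m z inside λ S →
    ≈-trans (+-identityˡ _) (*-congˡ (slice-inside-gen-zero S))

  L-slice-outside : ∀ m z → slice outside (L (suc m) z) ≐ z zero ⊛ L m (z ∘ suc)
  L-slice-outside m z = L-slice m z outside λ S →
    ≈-trans (+-congˡ (zeroʳ _)) (+-identityʳ _)

  L-slice-inside : ∀ m z → slice inside (L (suc m) z) ≐ (- 1#) ⊛ L m (z ∘ suc)
  L-slice-inside m z = L-slice m z inside λ S →
    ≈-trans (+-congʳ (zeroʳ (z zero))) (≈-trans (+-identityˡ _) (*-congˡ (slice-inside-gen-zero S)))

  pairing-cong : ∀ {m} {a a′ b b′ : Gr m} → a ≐ a′ → b ≐ b′ → pairing a b ≈ pairing a′ b′
  pairing-cong {m} a≐a′ b≐b′ = Σ-cong (allSubsets m) λ D → *-cong (a≐a′ D) (b≐b′ D)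

  pairing-slices : ∀ {m} (a b : Gr (suc m)) →
                   pairing a b ≈ pairing (slice outside a) (slice outside b) + pairing (slice inside a) (slice inside b)
  pairing-slices {m} a b = Σ-subsets-suc m _

  pairing-⊛ : ∀ {m} x y (a b : Gr m) → pairing (x ⊛ a) (y ⊛ b) ≈ (x * y) * pairing a b
  pairing-⊛ {m} x y a b = ≈-trans (Σ-cong (allSubsets m) λ D → interchange x (a D) y (b D)) (Σ-*ˡ (allSubsets m) (x * y) _)

  pairing-L-K : ∀ m (z w : Fin m → Carrier) → pairing (L m z) (K m w) ≈ ∏[ allFin m ] (λ i → z i - w i)
  pairing-L-K zero    z w = ≈-trans (+-identityʳ _) (*-identityˡ _)
  pairing-L-K (suc m) z w = begin
    pairing (L (suc m) z) (K (suc m) w)                                           ≈⟨ pairing-slices (L (suc m) z) (K (suc m) w) ⟩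
    pairing (slice outside (L (suc m) z)) (slice outside (K (suc m) w)) +
    pairing (slice inside (L (suc m) z)) (slice inside (K (suc m) w))             ≈⟨ +-cong (pairing-cong (L-slice-outside m z) (K-slice-outside m w))
                                                                                             (pairing-cong (L-slice-inside m z) (K-slice-inside m w)) ⟩
    pairing (z zero ⊛ L′) (1# ⊛ K′) + pairing ((- 1#) ⊛ L′) (w zero ⊛ K′)        ≈⟨ +-cong (pairing-⊛ _ _ L′ K′) (pairing-⊛ _ _ L′ K′) ⟩
    (z zero * 1#) * pairing L′ K′ + ((- 1#) * w zero) * pairing L′ K′           ≈⟨ distribʳ _ _ _ ⟨
    (z zero * 1# + (- 1#) * w zero) * pairing L′ K′                             ≈⟨ *-cong (+-cong (*-identityʳ _) (-1*x≈-x _)) (pairing-L-K m (z ∘ suc) (w ∘ suc)) ⟩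
    (z zero - w zero) * ∏[ allFin m ] (λ i → z (suc i) - w (suc i))             ≡⟨ sym (∏-allFin-suc (λ i → z i - w i)) ⟩
    ∏[ allFin (suc m) ] (λ i → z i - w i)                                         ∎
    where
    L′ = L m (z ∘ suc)
    K′ = K m (w ∘ suc)

  prodDiff-≈0 : ∀ {m} y (I J : Composition (suc m)) → parts I ≢ parts J → prodDiff y I J ≈ 0#
  prodDiff-≈0 {m} y I J I≢J with ≢⇒∃yUp≡yLow y I J I≢J
  ... | i , yUp≡yLow = ∏-zero (allFin m) (∈-allFin i) (≈-trans (reflexive (cong (_- yLow y J i) yUp≡yLow)) (-‿inverseʳ _))

-- A specialisation with nonzero diagonal

indicator : Bool → ℤ
indicator true  = 1ℤ
indicator false = 0ℤ

lastLetterIndicator : List Bool → ℤ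
lastLetterIndicator w = maybe indicator 0ℤ (last w)

last-∷ʳ : ∀ {a} {A : Set a} (xs : List A) x → last (xs ++ [ x ]) ≡ just x
last-∷ʳ []           x = refl
last-∷ʳ (_ ∷ [])     x = refl
last-∷ʳ (_ ∷ y ∷ xs) x = last-∷ʳ (y ∷ xs) x

∣yUp-yLow∣≡1 : ∀ {m} (I : Composition (suc m)) i → ∣ yUp lastLetterIndicator I i -ℤ yLow lastLetterIndicator I i ∣ ≡ 1
∣yUp-yLow∣≡1 I i = begin
  ∣ lastLetterIndicator (w ++ [ not b ]) -ℤ lastLetterIndicator (take (suc (toℕ i)) (toList u)) ∣
    ≡⟨ cong (λ v → ∣ lastLetterIndicator (w ++ [ not b ]) -ℤ lastLetterIndicator v ∣) (take-suc-toList u i) ⟩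
  ∣ lastLetterIndicator (w ++ [ not b ]) -ℤ lastLetterIndicator (w ++ [ b ]) ∣
    ≡⟨ cong₂ (λ x y → ∣ x -ℤ y ∣) (cong (maybe indicator 0ℤ) (last-∷ʳ w (not b))) (cong (maybe indicator 0ℤ) (last-∷ʳ w b)) ⟩
  ∣ indicator (not b) -ℤ indicator b ∣
    ≡⟨ ∣indicator-not-indicator∣ b ⟩
  1 ∎
  where
  open ≡-Reasoning
  u = desWord I
  w = take (toℕ i) (toList u)
  b = lookup u i
  ∣indicator-not-indicator∣ : ∀ b → ∣ indicator (not b) -ℤ indicator b ∣ ≡ 1
  ∣indicator-not-indicator∣ true  = refl
  ∣indicator-not-indicator∣ false = refl

module ℤProduct = Product +-*-commutativeRing

∣∏∣≡1 : ∀ {A : Set} (f : A → ℤ) xs → (∀ x → ∣ f x ∣ ≡ 1) → ∣ ℤProduct.∏[ xs ] f ∣ ≡ 1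
∣∏∣≡1 f []       ∣f∣≡1 = refl
∣∏∣≡1 f (x ∷ xs) ∣f∣≡1 = trans (abs-* (f x) _) (cong₂ Data.Nat._*_ (∣f∣≡1 x) (∣∏∣≡1 f xs ∣f∣≡1))

prodDiff-lastLetterIndicator≢0 : ∀ {m} (I : Composition (suc m)) →
                                  Grassmann.prodDiff +-*-commutativeRing lastLetterIndicator I I ≢ 0ℤ
prodDiff-lastLetterIndicator≢0 {m} I prodDiff≡0 = contradiction (trans (sym ∣prodDiff∣≡1) (cong ∣_∣ prodDiff≡0)) λ ()
  where
  ∣prodDiff∣≡1 : ∣ Grassmann.prodDiff +-*-commutativeRing lastLetterIndicator I I ∣ ≡ 1
  ∣prodDiff∣≡1 = ∣∏∣≡1 (λ i → yUp lastLetterIndicator I i -ℤ yLow lastLetterIndicator I i) (allFin m) (∣yUp-yLow∣≡1 I)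

mainTheorem2 : {c ℓ : Level}
             → (∀ (R : CommutativeRing c ℓ) (m : ℕ)
                 (y : List Bool → CommutativeRing.Carrier R)
                 (I J : Composition (suc m))
                 → CommutativeRing._≈_ R
                     (Grassmann.pairing R (Grassmann.Q R y I) (Grassmann.P R y J))
                     (Grassmann.prodDiff R y I J)
                   × (parts I ≢ parts J
                      → CommutativeRing._≈_ R (Grassmann.prodDiff R y I J) (CommutativeRing.0# R)))
               × (∀ (m : ℕ) (I : Composition (suc m))
                   → ∃ λ (y : List Bool → ℤ)
                       → Grassmann.prodDiff +-*-commutativeRing y I I ≢ Data.Integer.0ℤ)
mainTheorem2 = (λ R m y I J → pairing-L-K R m (yUp y I) (yLow y J) , prodDiff-≈0 R y I J)
             , λ m I → lastLetterIndicator , prodDiff-lastLetterIndicator≢0 I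
  where open GrassmannProperties using (pairing-L-K; prodDiff-≈0)
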